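{- Let the diamond graph be the graph on vertices $d_1,d_2,d_3,d_4$ with edges $d_1d_2$, $d_1d_3$, $d_2d_3$, $d_2d_4$, $d_3d_4$ (i.e. $K_4$ minus the edge $d_1d_4$). Let $H$ be the $(d_2,1)$-ordering of the diamond graph. Then $R_<(H)\le 13$.
   Context: A $k$-ordering of a graph $H$ assigns distinct order-labels from $\{1,\ldots,|H|\}$ to $k$ of the vertices of $H$. For a vertex $v$ of $H$ and $1\le l\le |H|$, the $(v,l)$-ordering of $H$ is the 1-ordering in which $v$ receives order-label $l$ and no other vertex is labeled. An ordered 2-coloring on $n$ vertices is a red/blue coloring of the edges of the complete graph on vertex set $\{1,\ldots,n\}$. It contains a $k$-ordering $H$ (in a given color) if it has a subgraph isomorphic to $H$, all of whose edges have that color, such that for every $i$ the $i$-th smallest vertex of the copy corresponds to a vertex of $H$ that has order-label $i$ or no order-label. $R_<(H)$ is the least $n$ such that every ordered 2-coloring on $n$ vertices contains a monochromatic (red or blue) copy of $H$. -}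

module Defs where

open import Data.Nat using (ℕ; _≤_)
open import Data.Fin using (Fin; toℕ; zero; suc) renaming (_<_ to _<ᶠ_)
open import Data.Fin.Properties using (_<?_)
open import Data.Maybe using (Maybe; just; nothing)
open import Data.Bool using (Bool; true; false)
open import Data.List using (List; length; filter; []; _∷_)
open import Data.List.Relation.Unary.All using (All)
open import Data.Product using (_×_; _,_; Σ; ∃)
open import Data.Sum using (_⊎_)
open import Relation.Binary.PropositionalEquality using (_≡_; _≢_)
open import Function.Definitions using (Injective)
open import Data.Vec.Functional using () 
open import Data.List using (allFin)

-- A finite simple graph on vertex set Fin m, given by a list of edges
-- (unordered pairs, each listed once in some orientation, no loops).
record Graph : Set where
  field
    size  : ℕ
    edges : List (Fin size × Fin size)
open Graph public

data Color : Set where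
  red blue : Color

record OrderedColoring (n : ℕ) : Set where
  field
    col  : Fin n → Fin n → Color
    symm : ∀ i j → col i j ≡ col j i
open OrderedColoring public

-- A (partial) ordering of H: each vertex gets either an order-label in
-- {1,…,|H|} (represented 0-based as Fin |H|) or no label; distinct labeled
-- vertices get distinct labels.
record Ordering (H : Graph) : Set where
  field
    label     : Fin (size H) → Maybe (Fin (size H))
    distinct  : ∀ u v l → label u ≡ just l → label v ≡ just l → u ≡ v
open Ordering public

-- The (v,l)-ordering of H: v gets order-label l (0-based here), nothing else labeled.
vlOrdering : (H : Graph) → Fin (size H) → Fin (size H) → Ordering H
vlOrdering H v l = record { label = lab ; distinct = dist }
  where
  open import Data.Fin using (_≟_)
  open import Relation.Nullary using (yes; no)
  open import Relation.Binary.PropositionalEquality using (refl; trans; sym)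
  lab : Fin (size H) → Maybe (Fin (size H))
  lab u with u ≟ v
  ... | yes _ = just l
  ... | no  _ = nothing
  dist : ∀ u w l' → lab u ≡ just l' → lab w ≡ just l' → u ≡ w
  dist u w l' p q with u ≟ v | w ≟ v
  ... | yes a | yes b = trans a (sym b)
  dist u w l' () q | no _ | _
  dist u w l' p () | yes _ | no _

rankBelow : ∀ {m n} → (Fin m → Fin n) → Fin n → ℕ
rankBelow {m} φ x = length (filter (λ w → φ w <? x) (allFin m))

-- The ordered coloring c contains the ordering O of H in color κ:
-- an injective embedding φ of the vertices of H into {1,…,n} such that every
-- edge of H is mapped to an edge of color κ, and every labeled vertex v with
-- label l is mapped to the l-th smallest vertex of the copy.
record Contains {n : ℕ} (c : OrderedColoring n) (H : Graph) (O : Ordering H)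
                (κ : Color) : Set where
  field
    φ       : Fin (size H) → Fin n
    inj     : Injective _≡_ _≡_ φ
    edgesOk : All (λ e → col c (φ (Data.Product.proj₁ e)) (φ (Data.Product.proj₂ e)) ≡ κ)
                  (edges H)
    orderOk : ∀ v l → label O v ≡ just l → rankBelow φ (φ v) ≡ toℕ l

Arrows : ℕ → (H : Graph) → Ordering H → Set
Arrows n H O = ∀ (c : OrderedColoring n) → Contains c H O red ⊎ Contains c H O blue

-- R_<(H) ≤ N : the least n with Arrows n H O is at most N, i.e. some n ≤ N arrows.
OrdRamseyLE : (H : Graph) → Ordering H → ℕ → Set
OrdRamseyLE H O N = Σ ℕ (λ n → n ≤ N × Arrows n H O)

-- The diamond graph: d₁,d₂,d₃,d₄ = 0,1,2,3; K₄ minus the edge d₁d₄.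
diamond : Graph
diamond = record
  { size  = 4
  ; edges = (zero , suc zero) ∷ (zero , suc (suc zero)) ∷ (suc zero , suc (suc zero))
          ∷ (suc zero , suc (suc (suc zero))) ∷ (suc (suc zero) , suc (suc (suc zero))) ∷ []
  }

d₂ : Fin 4
d₂ = suc zero

-- order-label 1 (0-based: zero)
label1 : Fin 4
label1 = zero

module Submission where

-- The diamond is the book B₂: a spine vx (here d₂d₃) with two pages a, b
-- (d₁, d₄) adjacent to both, and H only asks that v be the least vertex.
-- In a coloring of 12 vertices, the least vertex has 6 later neighbours in
-- one colour κ; let w be the least of them.  If two of the remaining 5 are
-- joined to w in κ they give a κ-book on the spine 0w.  Otherwise 4 are
-- joined to w in the other colour κ̄; let u be the least of those.  Two of
-- the remaining 3 are joined to u in the same colour, giving a κ-book on 0u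
-- or a κ̄-book on wu.  So 12 vertices already suffice.

open import Defs
open import Data.Bool using (true; false)
open import Data.Empty using (⊥-elim)
open import Data.Fin using (Fin; zero; suc; _<_; toℕ)
open import Data.Fin.Properties using (_<?_; <-trans; <-asym; <-irrefl; <⇒≢)
open import Data.List using (List; []; _∷_; length; filter; allFin)
open import Data.List.Properties using (filter-none; length-tabulate)
open import Data.List.Relation.Unary.All as All using (All; []; _∷_)
import Data.List.Relation.Unary.All.Properties as Allₚ
open import Data.List.Relation.Unary.AllPairs using (AllPairs; []; _∷_)
import Data.List.Relation.Unary.AllPairs.Properties as AllPairsₚ
open import Data.Maybe using (just)
open import Data.Nat using (ℕ; suc; _+_; _≤_; _≤?_; s≤s)
open import Data.Nat.Properties using (+-suc; ≤-trans; ≤-reflexive; n≤1+n; +-mono-≤; <⇒≱; ≰⇒>; ≮⇒≥)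
open import Data.Product using (Σ-syntax; _×_; _,_; proj₁; proj₂; map₁; map₂)
open import Data.Sum using (_⊎_; inj₁; inj₂)
import Data.Sum as Sum
open import Function using (id; _∘′_)
open import Level using (0ℓ)
open import Relation.Nullary using (¬_; Dec; yes; no; does)
open import Relation.Unary using (Pred; Decidable; U; ∁; _∩_; _⊆_)
open import Relation.Unary.Properties using (∁?)
open import Relation.Binary.PropositionalEquality using (_≡_; _≢_; refl; sym; trans; cong)

flip : Color → Color
flip red  = blue
flip blue = red

_≟ᶜ_ : (κ λ′ : Color) → Dec (κ ≡ λ′)
red  ≟ᶜ red  = yes refl
red  ≟ᶜ blue = no λ ()
blue ≟ᶜ red  = no λ ()
blue ≟ᶜ blue = yes refl

≢⇒≡flip : ∀ {κ λ′} → κ ≢ λ′ → κ ≡ flip λ′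
≢⇒≡flip {red}  {red}  κ≢λ′ = ⊥-elim (κ≢λ′ refl)
≢⇒≡flip {red}  {blue} _    = refl
≢⇒≡flip {blue} {red}  _    = refl
≢⇒≡flip {blue} {blue} κ≢λ′ = ⊥-elim (κ≢λ′ refl)

length-filter+length-filter-∁ : ∀ {A : Set} {P : Pred A 0ℓ} (P? : Decidable P) xs →
                                length (filter P? xs) + length (filter (∁? P?) xs) ≡ length xs
length-filter+length-filter-∁ P? [] = refl
length-filter+length-filter-∁ P? (x ∷ xs) with does (P? x)
... | true  = cong suc (length-filter+length-filter-∁ P? xs)
... | false = trans (+-suc _ _) (cong suc (length-filter+length-filter-∁ P? xs))

pigeonhole : ∀ p q {k o} → suc (p + q) ≤ k + o → suc p ≤ k ⊎ suc q ≤ o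
pigeonhole p q {k} h with suc p ≤? k
... | yes p<k = inj₁ p<k
... | no  p≮k = inj₂ (≰⇒> λ o≤q → <⇒≱ h (+-mono-≤ (≮⇒≥ p≮k) o≤q))

record Chain {n : ℕ} (k : ℕ) (P : Pred (Fin n) 0ℓ) : Set where
  constructor chain
  field
    list   : List (Fin n)
    sorted : AllPairs _<_ list
    all    : All P list
    long   : k ≤ length list

module _ {n : ℕ} where

  vertices : Chain n (U {A = Fin n})
  vertices = chain (allFin n) (AllPairsₚ.tabulate⁺-< id) (All.universal-U (allFin n))
                   (≤-reflexive (sym (length-tabulate id)))

  mapChain : ∀ {k} {P Q : Pred (Fin n) 0ℓ} → P ⊆ Q → Chain k P → Chain k Q
  mapChain P⊆Q (chain zs sorted all long) = chain zs sorted (All.map P⊆Q all) long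

  splitChain : ∀ {P Q : Pred (Fin n) 0ℓ} p q → Decidable Q → Chain (suc (p + q)) P →
               Chain (suc p) (P ∩ Q) ⊎ Chain (suc q) (P ∩ ∁ Q)
  splitChain p q Q? (chain zs sorted all long)
    with pigeonhole p q (≤-trans long (≤-reflexive (sym (length-filter+length-filter-∁ Q? zs))))
  ... | inj₁ long₁ = inj₁ (chain _ (AllPairsₚ.filter⁺ Q? sorted)
                                   (All.zip (Allₚ.filter⁺ Q? all , Allₚ.all-filter Q? zs)) long₁)
  ... | inj₂ long₂ = inj₂ (chain _ (AllPairsₚ.filter⁺ (∁? Q?) sorted)
                                   (All.zip (Allₚ.filter⁺ (∁? Q?) all , Allₚ.all-filter (∁? Q?) zs)) long₂)

H : Ordering diamond
H = vlOrdering diamond d₂ label1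

module BookEmbedding {n : ℕ} {v x a b : Fin n} (v<x : v < x) (x<a : x < a) (a<b : a < b) where

  φ : Fin 4 → Fin n
  φ zero                   = a
  φ (suc zero)             = v
  φ (suc (suc zero))       = x
  φ (suc (suc (suc zero))) = b

  v<a : v < a
  v<a = <-trans v<x x<a

  v<b : v < b
  v<b = <-trans v<a a<b

  x<b : x < b
  x<b = <-trans x<a a<b

  φ-injective : ∀ i j → φ i ≡ φ j → i ≡ j
  φ-injective zero                   zero                   _  = refl
  φ-injective zero                   (suc zero)             eq = ⊥-elim (<⇒≢ v<a (sym eq))
  φ-injective zero                   (suc (suc zero))       eq = ⊥-elim (<⇒≢ x<a (sym eq))
  φ-injective zero                   (suc (suc (suc zero))) eq = ⊥-elim (<⇒≢ a<b eq)
  φ-injective (suc zero)             zero                   eq = ⊥-elim (<⇒≢ v<a eq)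
  φ-injective (suc zero)             (suc zero)             _  = refl
  φ-injective (suc zero)             (suc (suc zero))       eq = ⊥-elim (<⇒≢ v<x eq)
  φ-injective (suc zero)             (suc (suc (suc zero))) eq = ⊥-elim (<⇒≢ v<b eq)
  φ-injective (suc (suc zero))       zero                   eq = ⊥-elim (<⇒≢ x<a eq)
  φ-injective (suc (suc zero))       (suc zero)             eq = ⊥-elim (<⇒≢ v<x (sym eq))
  φ-injective (suc (suc zero))       (suc (suc zero))       _  = refl
  φ-injective (suc (suc zero))       (suc (suc (suc zero))) eq = ⊥-elim (<⇒≢ x<b eq)
  φ-injective (suc (suc (suc zero))) zero                   eq = ⊥-elim (<⇒≢ a<b (sym eq))
  φ-injective (suc (suc (suc zero))) (suc zero)             eq = ⊥-elim (<⇒≢ v<b (sym eq))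
  φ-injective (suc (suc (suc zero))) (suc (suc zero))       eq = ⊥-elim (<⇒≢ x<b (sym eq))
  φ-injective (suc (suc (suc zero))) (suc (suc (suc zero))) _  = refl

  rankBelow-v : rankBelow φ v ≡ 0
  rankBelow-v = cong length (filter-none (λ w → φ w <? v) nothing-below-v)
    where
    nothing-below-v : All (λ w → ¬ φ w < v) (allFin 4)
    nothing-below-v = (λ a<v → <-asym a<v v<a) ∷ <-irrefl refl ∷ (λ x<v → <-asym x<v v<x)
                    ∷ (λ b<v → <-asym b<v v<b) ∷ []

  respects-H : ∀ u l → label H u ≡ just l → rankBelow φ (φ u) ≡ toℕ l
  respects-H (suc zero) zero refl = rankBelow-v

module _ {n : ℕ} (c : OrderedColoring n) where

  Nbr⁺ : Color → Fin n → Pred (Fin n) 0ℓ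
  Nbr⁺ κ v z = v < z × col c v z ≡ κ

  pivot : ∀ {P : Pred (Fin n) 0ℓ} p q κ → Chain (2 + p + q) P →
          Σ[ w ∈ Fin n ] P w × (Chain (suc p) (P ∩ Nbr⁺ κ w) ⊎ Chain (suc q) (P ∩ Nbr⁺ (flip κ) w))
  pivot {P} p q κ (chain (w ∷ zs) (w<zs ∷ sorted) (Pw ∷ Pzs) (s≤s long)) =
    w , Pw , Sum.map (mapChain reassoc) (mapChain (reassoc ∘′ map₂ ≢⇒≡flip))
                     (splitChain p q (λ z → col c w z ≟ᶜ κ) (chain zs sorted (All.zip (Pzs , w<zs)) long))
    where
    reassoc : ∀ {κ′} → (P ∩ (w <_)) ∩ (λ z → col c w z ≡ κ′) ⊆ P ∩ Nbr⁺ κ′ w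
    reassoc ((Pz , w<z) , wz) = Pz , w<z , wz

  book⇒diamond : ∀ {κ v x} → Nbr⁺ κ v x → Chain 2 (Nbr⁺ κ v ∩ Nbr⁺ κ x) → Contains c diamond H κ
  book⇒diamond (v<x , vx) (chain (a ∷ b ∷ _) ((a<b ∷ _) ∷ _) (((_ , va) , (x<a , xa)) ∷ ((_ , vb) , (_ , xb)) ∷ _) _) =
    record
    { φ       = φ
    ; inj     = φ-injective _ _
    ; edgesOk = trans (symm c a _) va ∷ trans (symm c a _) xa ∷ vx ∷ vb ∷ xb ∷ []
    ; orderOk = respects-H
    }
    where open BookEmbedding v<x x<a a<b
  book⇒diamond _ (chain (_ ∷ []) _ _ (s≤s ()))

  Monochromatic : Set
  Monochromatic = Contains c diamond H red ⊎ Contains c diamond H blue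

  monochromatic : ∀ {κ} → Contains c diamond H κ → Monochromatic
  monochromatic {red}  = inj₁
  monochromatic {blue} = inj₂

  mixed-star⇒diamond : ∀ {κ v w} → Chain 4 (Nbr⁺ κ v ∩ Nbr⁺ (flip κ) w) → Monochromatic
  mixed-star⇒diamond {κ} M with pivot 1 1 κ M
  ... | _ , (vu , _)  , inj₁ K = monochromatic (book⇒diamond vu (mapChain (map₁ proj₁) K))
  ... | _ , (_  , wu) , inj₂ O = monochromatic (book⇒diamond wu (mapChain (map₁ proj₂) O))

  star⇒diamond : ∀ {κ v} → Chain 6 (Nbr⁺ κ v) → Monochromatic
  star⇒diamond {κ} S with pivot 1 3 κ S
  ... | _ , vw , inj₁ K = monochromatic (book⇒diamond vw K)
  ... | _ , _  , inj₂ M = mixed-star⇒diamond M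

diamond-arrows : Arrows 12 diamond H
diamond-arrows c with pivot c 5 5 red vertices
... | _ , _ , inj₁ R = star⇒diamond c (mapChain proj₂ R)
... | _ , _ , inj₂ B = star⇒diamond c (mapChain proj₂ B)

theorem3p9 : OrdRamseyLE diamond (vlOrdering diamond d₂ label1) 13
theorem3p9 = 12 , n≤1+n 12 , diamond-arrows
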